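{- Let $G=(V,E)$ be a $uv$-sparse graph, where $u,v\in V$ are distinct, let $\mathcal{H}=\{X_1,\dots,X_k\}$ be a tight $uv$-compatible family in $G$, and suppose that $\mathcal{H}-X_i$ is not tight for all $1\le i\le k$. Then either: (a) $k=1$ and $X_1$ is tight; (b) $k=2$, $|X_1|=|X_2|=3$ and $i(X_1)=i(X_2)=2$; (c) $k=2$, $|X_1|\ge4$, $i(X_1)=2|X_1|-3$, $|X_2|=3$ and $i(X_2)=2$; or (d) $k=2$, $|X_i|\ge4$ and $i(X_i)=2|X_i|-3$ for all $i\in\{1,2\}$.
   Context: $i(X)$ counts edges with both ends in $X\subseteq V$; for a family $\mathcal{H}=\{H_1,\dots,H_k\}$, $i(\mathcal{H})$ counts edges with both ends in some $H_j$. For nonempty $H\subseteq V$, $\mathrm{val}(H)=2|H|-t_H$ with $t_H=4$ if $H=\{u,v\}$, $t_H=3$ if $H\ne\{u,v\}$ and $|H|\in\{2,3\}$, $t_H=2$ otherwise. $\mathcal{H}$ is $uv$-compatible if $u,v\in H_j$ and $|H_j|\ge3$ for all $j$, with $\mathrm{val}(\mathcal{H})=\sum_j\mathrm{val}(H_j)-2(k-1)$. $G$ is $uv$-sparse if $i(H)\le\mathrm{val}(H)$ for all $H\subseteq V$ with $|H|\ge2$ and $i(\mathcal{H})\le\mathrm{val}(\mathcal{H})$ for all $uv$-compatible $\mathcal{H}$. A set ($|H|\ge2$) or family is tight if $i=\mathrm{val}$. -}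

module Defs where

open import Data.Nat as ℕ using (ℕ; zero; suc)
open import Data.Integer as ℤ using (ℤ; +_)
open import Data.Bool using (Bool; true; false; _∧_; _∨_; if_then_else_)
open import Data.Fin using (Fin; zero; suc; _<?_)
open import Data.Fin.Subset using (Subset; ∣_∣; ⁅_⁆; _∪_)
open import Data.Vec using (lookup)
open import Data.Vec.Properties using (≡-dec)
open import Data.Product using (_×_)
open import Relation.Nullary using (does; ¬_)
open import Relation.Binary.PropositionalEquality using (_≡_)
open import Function.Definitions using (Injective)
import Data.Bool as B

sumFin : ∀ {n} → (Fin n → ℕ) → ℕ
sumFin {zero}  f = 0
sumFin {suc n} f = f zero ℕ.+ sumFin (λ i → f (suc i))

sumFinℤ : ∀ {n} → (Fin n → ℤ) → ℤ
sumFinℤ {zero}  f = + 0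
sumFinℤ {suc n} f = f zero ℤ.+ sumFinℤ (λ i → f (suc i))

anyFin : ∀ {n} → (Fin n → Bool) → Bool
anyFin {zero}  f = false
anyFin {suc n} f = f zero ∨ anyFin (λ i → f (suc i))

b2n : Bool → ℕ
b2n true  = 1
b2n false = 0

record Graph (n : ℕ) : Set where
  field
    adj     : Fin n → Fin n → Bool
    adj-sym : ∀ a b → adj a b ≡ adj b a
    adj-irr : ∀ a → adj a a ≡ false
open Graph public

countEdges : ∀ {n} → Graph n → (Fin n → Fin n → Bool) → ℕ
countEdges G P =
  sumFin (λ a → sumFin (λ b → b2n (does (a <? b) ∧ adj G a b ∧ P a b)))

iSet : ∀ {n} → Graph n → Subset n → ℕ
iSet G X = countEdges G (λ a b → lookup X a ∧ lookup X b)

Family : ℕ → ℕ → Set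
Family n k = Fin k → Subset n

iFam : ∀ {n k} → Graph n → Family n k → ℕ
iFam G F = countEdges G (λ a b → anyFin (λ j → lookup (F j) a ∧ lookup (F j) b))

isUV : ∀ {n} → Fin n → Fin n → Subset n → Bool
isUV u v H = does (≡-dec B._≟_ H (⁅ u ⁆ ∪ ⁅ v ⁆))

isSmall : ℕ → Bool
isSmall 2 = true
isSmall 3 = true
isSmall _ = false

tH : ∀ {n} → Fin n → Fin n → Subset n → ℕ
tH u v H = if isUV u v H then 4 else (if isSmall ∣ H ∣ then 3 else 2)

val : ∀ {n} → Fin n → Fin n → Subset n → ℤ
val u v H = + (2 ℕ.* ∣ H ∣) ℤ.- + (tH u v H)

valFam : ∀ {n k} → Fin n → Fin n → Family n k → ℤ
valFam {k = k} u v F = sumFinℤ (λ j → val u v (F j)) ℤ.- (+ 2 ℤ.* (+ k ℤ.- + 1))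

record Compatible {n k} (u v : Fin n) (F : Family n k) : Set where
  field
    nonempty : 1 ℕ.≤ k
    distinct : Injective _≡_ _≡_ F
    has-u    : ∀ j → lookup (F j) u ≡ true
    has-v    : ∀ j → lookup (F j) v ≡ true
    size≥3   : ∀ j → 3 ℕ.≤ ∣ F j ∣

record Sparse {n} (G : Graph n) (u v : Fin n) : Set where
  field
    sets     : ∀ (H : Subset n) → 2 ℕ.≤ ∣ H ∣ → + (iSet G H) ℤ.≤ val u v H
    families : ∀ k (F : Family n k) → Compatible u v F → + (iFam G F) ℤ.≤ valFam u v F

TightSet : ∀ {n} → Graph n → Fin n → Fin n → Subset n → Set
TightSet G u v H = (2 ℕ.≤ ∣ H ∣) × (+ (iSet G H) ≡ val u v H)

TightFam : ∀ {n k} → Graph n → Fin n → Fin n → Family n k → Set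
TightFam G u v F = + (iFam G F) ≡ valFam u v F

-- Since every X_j has at least three vertices, X_j ≠ {u,v} and val(X_j) is the natural number
-- w_j = 2|X_j| − 3 if |X_j| = 3 and 2|X_j| − 2 otherwise, so tightness of ℋ reads
-- i(ℋ) + 2(k−1) = Σ w_j. Removing X_i leaves a uv-compatible family which is not tight, so by
-- sparsity i(ℋ − X_i) + 2(k−2) < Σ_{j≠i} w_j. As i(ℋ) ≤ i(ℋ − X_i) + d_i, where d_i counts the
-- edges spanned by X_i and by no other member, this gives w_i ≤ d_i + 1; summing over i and using
-- Σ d_i ≤ i(ℋ) yields 2(k−1) ≤ k, i.e. k ≤ 2. For k = 2 the removal inequalities i(X_j) < w_j and
-- i(ℋ) ≤ i(X_1) + i(X_2) together with tightness force i(X_j) = w_j − 1, which is (b), (c) or (d).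
module Submission where

open import Defs
open import Data.Nat using (ℕ; suc; _≤_; _*_; _∸_)
open import Data.Fin using (Fin)
open import Data.Fin.Subset using (∣_∣)
open import Data.Vec.Functional using (removeAt)
open import Data.Product using (_×_; ∃₂)
open import Data.Sum using (_⊎_)
open import Relation.Nullary using (¬_)
open import Relation.Binary.PropositionalEquality using (_≡_; _≢_)

open import Algebra.Bundles using (AbelianGroup; CommutativeMonoid)
open import Data.Bool using (Bool; true; false; _∧_; _∨_; not; if_then_else_)
import Data.Bool as Bool
open import Data.Bool.Properties using (∨-identityʳ; ∧-zeroʳ; ∨-commutativeMonoid)
open import Data.Empty using (⊥-elim)
open import Data.Fin using (zero; suc; punchIn; _<?_)
open import Data.Fin.Properties using (punchIn-injective)
open import Data.Fin.Subset using (Subset; ⁅_⁆; _∪_; inside; outside)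
open import Data.Fin.Subset.Properties using (∣⁅x⁆∣≡1)
open import Data.Integer as ℤ using (ℤ) renaming (+_ to pos)
import Data.Integer.Properties as ℤ
open import Data.Nat using (zero; _+_; z≤n; s≤s; pred)
open import Data.Nat.Properties hiding (_<?_)
open import Data.Nat.Tactic.RingSolver using (solve-∀)
open import Data.Product using (_,_; proj₁; proj₂)
open import Data.Sum using (inj₁; inj₂) renaming (map to map⊎)
open import Data.Vec using (_∷_; []; lookup)
open import Data.Vec.Properties using (≡-dec)
open import Function using (_∘_)
open import Relation.Nullary using (does; yes; no)
open import Relation.Binary.PropositionalEquality using (refl; sym; trans; cong; cong₂; module ≡-Reasoning)

open import Algebra.Properties.Group (AbelianGroup.group ℤ.+-0-abelianGroup)
  using (//-rightDividesˡ; //-rightDividesʳ)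
open import Algebra.Properties.CommutativeSemigroup +-commutativeSemigroup
  using () renaming (interchange to +-interchange; x∙yz≈y∙xz to +-left-comm)
open import Algebra.Properties.CommutativeSemigroup (CommutativeMonoid.commutativeSemigroup ∨-commutativeMonoid)
  using () renaming (x∙yz≈y∙xz to ∨-left-comm)

private
  variable
    n k : ℕ

sumFin-cong : {f g : Fin k → ℕ} → (∀ i → f i ≡ g i) → sumFin f ≡ sumFin g
sumFin-cong {zero}  f≗g = refl
sumFin-cong {suc k} f≗g = cong₂ _+_ (f≗g zero) (sumFin-cong (f≗g ∘ suc))

sumFin-mono : {f g : Fin k → ℕ} → (∀ i → f i ≤ g i) → sumFin f ≤ sumFin g
sumFin-mono {zero}  f≤g = z≤n
sumFin-mono {suc k} f≤g = +-mono-≤ (f≤g zero) (sumFin-mono (f≤g ∘ suc))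

sumFin-distrib-+ : (f g : Fin k → ℕ) → sumFin (λ i → f i + g i) ≡ sumFin f + sumFin g
sumFin-distrib-+ {zero}  f g = refl
sumFin-distrib-+ {suc k} f g = begin
  (f zero + g zero) + sumFin (λ i → f (suc i) + g (suc i))
    ≡⟨ cong (f zero + g zero +_) (sumFin-distrib-+ (f ∘ suc) (g ∘ suc)) ⟩
  (f zero + g zero) + (sumFin (f ∘ suc) + sumFin (g ∘ suc))
    ≡⟨ +-interchange (f zero) (g zero) _ _ ⟩
  (f zero + sumFin (f ∘ suc)) + (g zero + sumFin (g ∘ suc)) ∎
  where open ≡-Reasoning

sumFin-zero : sumFin {k} (λ _ → 0) ≡ 0
sumFin-zero {zero}  = refl
sumFin-zero {suc k} = sumFin-zero {k}

sumFin-one : sumFin {k} (λ _ → 1) ≡ k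
sumFin-one {zero}  = refl
sumFin-one {suc k} = cong suc (sumFin-one {k})

sumFin-comm : ∀ {m} (f : Fin m → Fin n → ℕ) →
  sumFin (λ i → sumFin (f i)) ≡ sumFin (λ j → sumFin (λ i → f i j))
sumFin-comm {n} {m = zero}  f = sym (sumFin-zero {n})
sumFin-comm {m = suc m} f =
  trans (cong (sumFin (f zero) +_) (sumFin-comm (f ∘ suc)))
        (sym (sumFin-distrib-+ (f zero) _))

sumFin-removeAt : (f : Fin (suc k) → ℕ) (i : Fin (suc k)) → sumFin f ≡ f i + sumFin (removeAt f i)
sumFin-removeAt         f zero    = refl
sumFin-removeAt {suc k} f (suc i) =
  trans (cong (f zero +_) (sumFin-removeAt (f ∘ suc) i)) (+-left-comm (f zero) (f (suc i)) _)

anyFin-removeAt : (f : Fin (suc k) → Bool) (i : Fin (suc k)) → anyFin f ≡ f i ∨ anyFin (removeAt f i)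
anyFin-removeAt         f zero    = refl
anyFin-removeAt {suc k} f (suc i) =
  trans (cong (f zero ∨_) (anyFin-removeAt (f ∘ suc) i)) (∨-left-comm (f zero) (f (suc i)) _)

isolated : (Fin (suc k) → Bool) → Fin (suc k) → Bool
isolated f i = f i ∧ not (anyFin (removeAt f i))

b2n≤1 : ∀ x → b2n x ≤ 1
b2n≤1 false = z≤n
b2n≤1 true  = s≤s z≤n

sumFin-isolated≤anyFin : (f : Fin (suc k) → Bool) → sumFin (b2n ∘ isolated f) ≤ b2n (anyFin f)
sumFin-isolated≤anyFin {zero}  f with f zero
... | true  = s≤s z≤n
... | false = z≤n
sumFin-isolated≤anyFin {suc k} f with f zero | sumFin-isolated≤anyFin (f ∘ suc)
... | false | rest = rest
... | true  | _    = begin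
  b2n (not (anyFin (f ∘ suc))) + sumFin (λ i → b2n (f (suc i) ∧ false))
    ≡⟨ cong (b2n (not (anyFin (f ∘ suc))) +_)
            (trans (sumFin-cong (cong b2n ∘ ∧-zeroʳ ∘ f ∘ suc)) (sumFin-zero {suc k})) ⟩
  b2n (not (anyFin (f ∘ suc))) + 0
    ≡⟨ +-identityʳ _ ⟩
  b2n (not (anyFin (f ∘ suc)))
    ≤⟨ b2n≤1 _ ⟩
  1 ∎
  where open ≤-Reasoning

b2n-∧-subadditive : ∀ x {p q r} → b2n p ≤ b2n q + b2n r →
  b2n (x ∧ p) ≤ b2n (x ∧ q) + b2n (x ∧ r)
b2n-∧-subadditive false _ = z≤n
b2n-∧-subadditive true  h = h

sumFin-b2n-∧ : ∀ x (p : Fin k → Bool) {q} → sumFin (b2n ∘ p) ≤ b2n q →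
  sumFin (λ i → b2n (x ∧ p i)) ≤ b2n (x ∧ q)
sumFin-b2n-∧ {k} false _ _ = ≤-reflexive (sumFin-zero {k})
sumFin-b2n-∧     true  _ h = h

module _ (G : Graph n) where

  private
    edgeTerm : (Fin n → Fin n → Bool) → Fin n → Fin n → ℕ
    edgeTerm P a b = b2n (does (a <? b) ∧ adj G a b ∧ P a b)

  countEdges-cong : {P Q : Fin n → Fin n → Bool} → (∀ a b → P a b ≡ Q a b) →
    countEdges G P ≡ countEdges G Q
  countEdges-cong P≗Q = sumFin-cong λ a → sumFin-cong λ b →
    cong (λ x → b2n (does (a <? b) ∧ adj G a b ∧ x)) (P≗Q a b)

  countEdges-subadditive : (P Q R : Fin n → Fin n → Bool) →
    (∀ a b → b2n (P a b) ≤ b2n (Q a b) + b2n (R a b)) →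
    countEdges G P ≤ countEdges G Q + countEdges G R
  countEdges-subadditive P Q R h = begin
    countEdges G P
      ≤⟨ sumFin-mono (λ a → sumFin-mono λ b →
           b2n-∧-subadditive (does (a <? b)) (b2n-∧-subadditive (adj G a b) (h a b))) ⟩
    sumFin (λ a → sumFin (λ b → edgeTerm Q a b + edgeTerm R a b))
      ≡⟨ sumFin-cong (λ a → sumFin-distrib-+ (edgeTerm Q a) (edgeTerm R a)) ⟩
    sumFin (λ a → sumFin (edgeTerm Q a) + sumFin (edgeTerm R a))
      ≡⟨ sumFin-distrib-+ (λ a → sumFin (edgeTerm Q a)) (λ a → sumFin (edgeTerm R a)) ⟩
    countEdges G Q + countEdges G R ∎
    where open ≤-Reasoning

  sumFin-countEdges≤ : (P : Fin k → Fin n → Fin n → Bool) (Q : Fin n → Fin n → Bool) →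
    (∀ a b → sumFin (λ i → b2n (P i a b)) ≤ b2n (Q a b)) →
    sumFin (λ i → countEdges G (P i)) ≤ countEdges G Q
  sumFin-countEdges≤ P Q h = begin
    sumFin (λ i → sumFin (λ a → sumFin (λ b → edgeTerm (P i) a b)))
      ≡⟨ sumFin-comm (λ i a → sumFin (edgeTerm (P i) a)) ⟩
    sumFin (λ a → sumFin (λ i → sumFin (λ b → edgeTerm (P i) a b)))
      ≡⟨ sumFin-cong (λ a → sumFin-comm (λ i → edgeTerm (P i) a)) ⟩
    sumFin (λ a → sumFin (λ b → sumFin (λ i → edgeTerm (P i) a b)))
      ≤⟨ sumFin-mono (λ a → sumFin-mono λ b →
           sumFin-b2n-∧ (does (a <? b)) (λ i → adj G a b ∧ P i a b)
             (sumFin-b2n-∧ (adj G a b) (λ i → P i a b) (h a b))) ⟩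
    countEdges G Q ∎
    where open ≤-Reasoning

spannedBy : Family n k → Fin k → Fin n → Fin n → Bool
spannedBy X j a b = lookup (X j) a ∧ lookup (X j) b

spannedOnlyBy : Family n (suc k) → Fin (suc k) → Fin n → Fin n → Bool
spannedOnlyBy X i a b = isolated (λ j → spannedBy X j a b) i

module _ (G : Graph n) where

  iFam-singleton : (X : Family n 1) → iFam G X ≡ iSet G (X zero)
  iFam-singleton X = countEdges-cong G (λ a b → ∨-identityʳ _)

  iFam-pair≤ : (X : Family n 2) → iFam G X ≤ iSet G (X zero) + iSet G (X (suc zero))
  iFam-pair≤ X = countEdges-subadditive G _ (spannedBy X zero) (spannedBy X (suc zero)) λ a b →
    b2n-∨ (spannedBy X zero a b) _
    where
    b2n-∨ : ∀ p q → b2n (p ∨ (q ∨ false)) ≤ b2n p + b2n q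
    b2n-∨ false false = z≤n
    b2n-∨ false true  = s≤s z≤n
    b2n-∨ true  q     = s≤s z≤n

  iFam≤iFam-removeAt+only : (X : Family n (suc k)) (i : Fin (suc k)) →
    iFam G X ≤ iFam G (removeAt X i) + countEdges G (spannedOnlyBy X i)
  iFam≤iFam-removeAt+only X i = countEdges-subadditive G _ _ (spannedOnlyBy X i) λ a b →
    ≤-reflexive (trans (cong b2n (anyFin-removeAt (λ j → spannedBy X j a b) i))
                       (b2n-∨ (spannedBy X i a b) _))
    where
    b2n-∨ : ∀ p q → b2n (p ∨ q) ≡ b2n q + b2n (p ∧ not q)
    b2n-∨ false q     = sym (+-identityʳ _)
    b2n-∨ true  false = refl
    b2n-∨ true  true  = refl

  sumFin-only≤iFam : (X : Family n (suc k)) →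
    sumFin (λ i → countEdges G (spannedOnlyBy X i)) ≤ iFam G X
  sumFin-only≤iFam X = sumFin-countEdges≤ G (spannedOnlyBy X) _ λ a b →
    sumFin-isolated≤anyFin (λ j → spannedBy X j a b)

-- val H = 2|H| − t_H for H ≠ {u,v}, as a function of |H|.
weight : ℕ → ℕ
weight c = 2 * c ∸ (if isSmall c then 3 else 2)

∣p∪q∣≤∣p∣+∣q∣ : (p q : Subset n) → ∣ p ∪ q ∣ ≤ ∣ p ∣ + ∣ q ∣
∣p∪q∣≤∣p∣+∣q∣ []            []            = z≤n
∣p∪q∣≤∣p∣+∣q∣ (outside ∷ p) (outside ∷ q) = ∣p∪q∣≤∣p∣+∣q∣ p q
∣p∪q∣≤∣p∣+∣q∣ (outside ∷ p) (inside  ∷ q) =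
  ≤-trans (s≤s (∣p∪q∣≤∣p∣+∣q∣ p q)) (≤-reflexive (sym (+-suc ∣ p ∣ ∣ q ∣)))
∣p∪q∣≤∣p∣+∣q∣ (inside  ∷ p) (outside ∷ q) = s≤s (∣p∪q∣≤∣p∣+∣q∣ p q)
∣p∪q∣≤∣p∣+∣q∣ (inside  ∷ p) (inside  ∷ q) =
  s≤s (≤-trans (m≤n⇒m≤1+n (∣p∪q∣≤∣p∣+∣q∣ p q)) (≤-reflexive (sym (+-suc ∣ p ∣ ∣ q ∣))))

isUV-large : (u v : Fin n) (H : Subset n) → 3 ≤ ∣ H ∣ → isUV u v H ≡ false
isUV-large u v H 3≤∣H∣ with ≡-dec Bool._≟_ H (⁅ u ⁆ ∪ ⁅ v ⁆)
... | no  _    = refl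
... | yes refl = ⊥-elim (<⇒≱ 3≤∣H∣ (begin
  ∣ ⁅ u ⁆ ∪ ⁅ v ⁆ ∣     ≤⟨ ∣p∪q∣≤∣p∣+∣q∣ ⁅ u ⁆ ⁅ v ⁆ ⟩
  ∣ ⁅ u ⁆ ∣ + ∣ ⁅ v ⁆ ∣ ≡⟨ cong₂ _+_ (∣⁅x⁆∣≡1 u) (∣⁅x⁆∣≡1 v) ⟩
  2                     ∎))
  where open ≤-Reasoning

val≡weight : (u v : Fin n) (H : Subset n) → 3 ≤ ∣ H ∣ → val u v H ≡ pos (weight ∣ H ∣)
val≡weight u v H 3≤∣H∣ rewrite isUV-large u v H 3≤∣H∣ =
  trans (ℤ.[+m]-[+n]≡m⊖n (2 * ∣ H ∣) (offset ∣ H ∣))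
        (ℤ.⊖-≥ (≤-trans (offset≤4 ∣ H ∣) (*-monoʳ-≤ 2 (≤-trans (n≤1+n 2) 3≤∣H∣))))
  where
  offset : ℕ → ℕ
  offset c = if isSmall c then 3 else 2
  offset≤4 : ∀ c → offset c ≤ 2 * 2
  offset≤4 c with isSmall c
  ... | true  = s≤s (s≤s (s≤s z≤n))
  ... | false = s≤s (s≤s z≤n)

weight-classify : ∀ c i → 3 ≤ c → suc i ≡ weight c → (c ≡ 3 × i ≡ 2) ⊎ (4 ≤ c × i ≡ 2 * c ∸ 3)
weight-classify 0                         i ()                  _
weight-classify 1                         i (s≤s ())            _
weight-classify 2                         i (s≤s (s≤s ()))      _
weight-classify 3                         i _ e = inj₁ (refl , cong pred e)
weight-classify (suc (suc (suc (suc c)))) i _ e = inj₂ (s≤s (s≤s (s≤s (s≤s z≤n))) , cong pred e)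

weightSum : Family n k → ℕ
weightSum X = sumFin (λ j → weight ∣ X j ∣)

sumFinℤ-pos : {f : Fin k → ℤ} {g : Fin k → ℕ} → (∀ i → f i ≡ pos (g i)) → sumFinℤ f ≡ pos (sumFin g)
sumFinℤ-pos {zero}  f≗g = refl
sumFinℤ-pos {suc k} f≗g = cong₂ ℤ._+_ (f≗g zero) (sumFinℤ-pos (f≗g ∘ suc))

valFam≡weightSum-2k : (u v : Fin n) (X : Family n (suc k)) → (∀ j → 3 ≤ ∣ X j ∣) →
  valFam u v X ≡ pos (weightSum X) ℤ.- pos (2 * k)
valFam≡weightSum-2k {k = k} u v X large =
  cong₂ ℤ._-_ (sumFinℤ-pos (λ j → val≡weight u v (X j) (large j))) (sym (ℤ.pos-* 2 k))

pos≡pos-pos⇒+≡ : ∀ {a b c} → pos a ≡ pos b ℤ.- pos c → a + c ≡ b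
pos≡pos-pos⇒+≡ {a} {b} {c} e = ℤ.+-injective (begin
  pos a ℤ.+ pos c              ≡⟨ cong (ℤ._+ pos c) e ⟩
  pos b ℤ.- pos c ℤ.+ pos c    ≡⟨ //-rightDividesˡ (pos c) (pos b) ⟩
  pos b                        ∎)
  where open ≡-Reasoning

+≡⇒pos≡pos-pos : ∀ {a b c} → a + c ≡ b → pos a ≡ pos b ℤ.- pos c
+≡⇒pos≡pos-pos {a} {b} {c} refl = sym (//-rightDividesʳ (pos c) (pos a))

pos≤pos-pos⇒+≤ : ∀ {a b c} → pos a ℤ.≤ pos b ℤ.- pos c → a + c ≤ b
pos≤pos-pos⇒+≤ {a} {b} {c} le = ℤ.drop‿+≤+ (begin
  pos a ℤ.+ pos c              ≤⟨ ℤ.+-monoˡ-≤ (pos c) le ⟩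
  pos b ℤ.- pos c ℤ.+ pos c    ≡⟨ //-rightDividesˡ (pos c) (pos b) ⟩
  pos b                        ∎)
  where open ℤ.≤-Reasoning

removeAt-compatible : {u v : Fin n} {X : Family n (suc (suc k))} → Compatible u v X →
  ∀ i → Compatible u v (removeAt X i)
removeAt-compatible compatible i = record
  { nonempty = s≤s z≤n
  ; distinct = λ {x} {y} e → punchIn-injective i x y (distinct e)
  ; has-u    = has-u ∘ punchIn i
  ; has-v    = has-v ∘ punchIn i
  ; size≥3   = size≥3 ∘ punchIn i
  }
  where open Compatible compatible

tight⇒iFam+2k≡weightSum : (G : Graph n) {u v : Fin n} {X : Family n (suc k)} →
  Compatible u v X → TightFam G u v X → iFam G X + 2 * k ≡ weightSum X
tight⇒iFam+2k≡weightSum G {u} {v} {X} compatible tight =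
  pos≡pos-pos⇒+≡ (trans tight (valFam≡weightSum-2k u v X (Compatible.size≥3 compatible)))

sparse∧¬tight⇒iFam+2k<weightSum : {G : Graph n} {u v : Fin n} → Sparse G u v →
  ∀ {k} {X : Family n (suc k)} → Compatible u v X → ¬ TightFam G u v X →
  suc (iFam G X + 2 * k) ≤ weightSum X
sparse∧¬tight⇒iFam+2k<weightSum {u = u} {v} sparse {k} {X} compatible ¬tight = ≤∧≢⇒<
  (pos≤pos-pos⇒+≤ (ℤ.≤-trans (Sparse.families sparse _ X compatible) (ℤ.≤-reflexive valFam≡)))
  (λ e → ¬tight (trans (+≡⇒pos≡pos-pos e) (sym valFam≡)))
  where
  valFam≡ : valFam u v X ≡ pos (weightSum X) ℤ.- pos (2 * k)
  valFam≡ = valFam≡weightSum-2k u v X (Compatible.size≥3 compatible)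

singleton-tight : (G : Graph n) {u v : Fin n} {X : Family n 1} →
  Compatible u v X → TightFam G u v X → TightSet G u v (X zero)
singleton-tight G {u} {v} {X} compatible tight =
  ≤-trans (n≤1+n 2) (Compatible.size≥3 compatible zero) , (begin
    pos (iSet G (X zero))           ≡⟨ cong pos (iFam-singleton G X) ⟨
    pos (iFam G X)                  ≡⟨ tight ⟩
    val u v (X zero) ℤ.+ pos 0 ℤ.+ pos 0 ≡⟨ trans (ℤ.+-identityʳ _) (ℤ.+-identityʳ _) ⟩
    val u v (X zero)                ∎)
  where open ≡-Reasoning

≤∧≤∧+≤+⇒≡∧≡ : ∀ {a b c d} → a ≤ b → c ≤ d → b + d ≤ a + c → a ≡ b × c ≡ d
≤∧≤∧+≤+⇒≡∧≡ {a} {b} {c} {d} a≤b c≤d b+d≤a+c =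
  ≤-antisym a≤b (+-cancelʳ-≤ d b a (≤-trans b+d≤a+c (+-monoʳ-≤ a c≤d))) ,
  ≤-antisym c≤d (+-cancelˡ-≤ b d c (≤-trans b+d≤a+c (+-monoˡ-≤ c a≤b)))

module Critical {G : Graph n} {u v : Fin n} (sparse : Sparse G u v)
  {k} {X : Family n (suc (suc k))} (compatible : Compatible u v X) (tight : TightFam G u v X)
  (minimal : ∀ i → ¬ TightFam G u v (removeAt X i)) where

  removeAt-slack : ∀ i → suc (iFam G (removeAt X i) + 2 * k) ≤ weightSum (removeAt X i)
  removeAt-slack i =
    sparse∧¬tight⇒iFam+2k<weightSum sparse (removeAt-compatible compatible i) (minimal i)

  weight≤suc-only : ∀ i → weight ∣ X i ∣ ≤ suc (countEdges G (spannedOnlyBy X i))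
  weight≤suc-only i = +-cancelʳ-≤ (suc (A + 2 * k)) (weight ∣ X i ∣) (suc D) (begin
    weight ∣ X i ∣ + suc (A + 2 * k)          ≤⟨ +-monoʳ-≤ (weight ∣ X i ∣) (removeAt-slack i) ⟩
    weight ∣ X i ∣ + weightSum (removeAt X i) ≡⟨ sumFin-removeAt (λ j → weight ∣ X j ∣) i ⟨
    weightSum X                               ≡⟨ tight⇒iFam+2k≡weightSum G compatible tight ⟨
    iFam G X + 2 * suc k                      ≤⟨ +-monoˡ-≤ (2 * suc k) (iFam≤iFam-removeAt+only G X i) ⟩
    (A + D) + 2 * suc k                       ≡⟨ regroup A D k ⟩
    suc D + suc (A + 2 * k)                   ∎)
    where
    open ≤-Reasoning
    A D : ℕ
    A = iFam G (removeAt X i)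
    D = countEdges G (spannedOnlyBy X i)
    regroup : ∀ a d k → (a + d) + 2 * suc k ≡ suc d + suc (a + 2 * k)
    regroup = solve-∀

  size≡2 : k ≡ 0
  size≡2 = 2*suc≤2+⇒≡0 (+-cancelʳ-≤ I (2 * suc k) (2 + k) (begin
    2 * suc k + I                           ≡⟨ +-comm (2 * suc k) I ⟩
    I + 2 * suc k                           ≡⟨ tight⇒iFam+2k≡weightSum G compatible tight ⟩
    weightSum X                             ≤⟨ sumFin-mono weight≤suc-only ⟩
    sumFin (λ i → 1 + Dᵢ i)                 ≡⟨ sumFin-distrib-+ (λ _ → 1) Dᵢ ⟩
    sumFin {2 + k} (λ _ → 1) + sumFin Dᵢ    ≡⟨ cong (_+ sumFin Dᵢ) (sumFin-one {2 + k}) ⟩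
    2 + k + sumFin Dᵢ                       ≤⟨ +-monoʳ-≤ (2 + k) (sumFin-only≤iFam G X) ⟩
    2 + k + I                               ∎))
    where
    open ≤-Reasoning
    I : ℕ
    I = iFam G X
    Dᵢ : Fin (2 + k) → ℕ
    Dᵢ i = countEdges G (spannedOnlyBy X i)
    2*suc≤2+⇒≡0 : 2 * suc k ≤ 2 + k → k ≡ 0
    2*suc≤2+⇒≡0 h = n≤0⇒n≡0 (+-cancelˡ-≤ k k 0 (begin
      k + k ≤⟨ +-cancelˡ-≤ 2 (k + k) k (≤-trans (≤-reflexive (double-suc k)) h) ⟩
      k     ≡⟨ +-identityʳ k ⟨
      k + 0 ∎))
      where
      double-suc : ∀ k → 2 + (k + k) ≡ 2 * suc k
      double-suc = solve-∀

critical-pair : {G : Graph n} {u v : Fin n} → Sparse G u v →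
  {X : Family n 2} → Compatible u v X → TightFam G u v X → (∀ i → ¬ TightFam G u v (removeAt X i)) →
  suc (iSet G (X zero)) ≡ weight ∣ X zero ∣ × suc (iSet G (X (suc zero))) ≡ weight ∣ X (suc zero) ∣
critical-pair {G = G} sparse {X} compatible tight minimal =
  ≤∧≤∧+≤+⇒≡∧≡ (other-slack (suc zero)) (other-slack zero) (begin
    weight ∣ X zero ∣ + weight ∣ X (suc zero) ∣  ≡⟨ cong (weight ∣ X zero ∣ +_) (+-identityʳ _) ⟨
    weightSum X                                  ≡⟨ tight⇒iFam+2k≡weightSum G compatible tight ⟨
    iFam G X + 2                                 ≤⟨ +-monoˡ-≤ 2 (iFam-pair≤ G X) ⟩
    iSet G (X zero) + iSet G (X (suc zero)) + 2  ≡⟨ shift (iSet G (X zero)) _ ⟩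
    suc (iSet G (X zero)) + suc (iSet G (X (suc zero))) ∎)
  where
  open ≤-Reasoning
  open Critical sparse compatible tight minimal
  shift : ∀ a b → a + b + 2 ≡ suc a + suc b
  shift = solve-∀
  other-slack : ∀ i → suc (iSet G (X (punchIn i zero))) ≤ weight ∣ X (punchIn i zero) ∣
  other-slack i = begin
    suc (iSet G (X (punchIn i zero)))       ≡⟨ cong suc (trans (+-identityʳ _) (iFam-singleton G (removeAt X i))) ⟨
    suc (iFam G (removeAt X i) + 0)         ≤⟨ removeAt-slack i ⟩
    weight ∣ X (punchIn i zero) ∣ + 0       ≡⟨ +-identityʳ _ ⟩
    weight ∣ X (punchIn i zero) ∣           ∎

SmallNearlyTight : Graph n → Subset n → Set
SmallNearlyTight G H = ∣ H ∣ ≡ 3 × iSet G H ≡ 2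

LargeNearlyTight : Graph n → Subset n → Set
LargeNearlyTight G H = 4 ≤ ∣ H ∣ × iSet G H ≡ 2 * ∣ H ∣ ∸ 3

pair-outcome : (G : Graph n) (X : Family n 2) →
  SmallNearlyTight G (X zero) ⊎ LargeNearlyTight G (X zero) →
  SmallNearlyTight G (X (suc zero)) ⊎ LargeNearlyTight G (X (suc zero)) →
  (∀ i → SmallNearlyTight G (X i))
  ⊎ (∃₂ λ i j → i ≢ j × 4 ≤ ∣ X i ∣ × iSet G (X i) ≡ 2 * ∣ X i ∣ ∸ 3
                      × ∣ X j ∣ ≡ 3 × iSet G (X j) ≡ 2)
  ⊎ (∀ i → LargeNearlyTight G (X i))
pair-outcome G X (inj₁ s₀)       (inj₁ s₁)        = inj₁ λ { zero → s₀ ; (suc zero) → s₁ }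
pair-outcome G X (inj₂ (l , e))  (inj₁ (s , e′))  = inj₂ (inj₁ (zero , suc zero , (λ ()) , l , e , s , e′))
pair-outcome G X (inj₁ (s , e))  (inj₂ (l , e′))  = inj₂ (inj₁ (suc zero , zero , (λ ()) , l , e′ , s , e))
pair-outcome G X (inj₂ l₀)       (inj₂ l₁)        = inj₂ (inj₂ λ { zero → l₀ ; (suc zero) → l₁ })

lemma4p10 : ∀ {n} (G : Graph n) (u v : Fin n) → u ≢ v → Sparse G u v →
  ∀ k (X : Family n (suc k)) → Compatible u v X → TightFam G u v X →
  (∀ i → ¬ TightFam G u v (removeAt X i)) →
  (k ≡ 0 × (∀ i → TightSet G u v (X i)))
  ⊎ (k ≡ 1 × (∀ i → ∣ X i ∣ ≡ 3 × iSet G (X i) ≡ 2))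
  ⊎ (k ≡ 1 × ∃₂ λ i j → i ≢ j × 4 ≤ ∣ X i ∣ × iSet G (X i) ≡ 2 * ∣ X i ∣ ∸ 3
                               × ∣ X j ∣ ≡ 3 × iSet G (X j) ≡ 2)
  ⊎ (k ≡ 1 × (∀ i → 4 ≤ ∣ X i ∣ × iSet G (X i) ≡ 2 * ∣ X i ∣ ∸ 3))
lemma4p10 G u v _ sparse zero X compatible tight _ =
  inj₁ (refl , λ { zero → singleton-tight G compatible tight })
lemma4p10 G u v _ sparse (suc zero) X compatible tight minimal =
  inj₂ (map⊎ (refl ,_) (map⊎ (refl ,_) (refl ,_)) (pair-outcome G X
    (weight-classify _ _ (size≥3 zero)       (proj₁ nearlyTight))
    (weight-classify _ _ (size≥3 (suc zero)) (proj₂ nearlyTight))))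
  where
  open Compatible compatible
  nearlyTight : suc (iSet G (X zero)) ≡ weight ∣ X zero ∣
              × suc (iSet G (X (suc zero))) ≡ weight ∣ X (suc zero) ∣
  nearlyTight = critical-pair sparse compatible tight minimal
lemma4p10 G u v _ sparse (suc (suc k)) X compatible tight minimal
  with () ← Critical.size≡2 sparse compatible tight minimal
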